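{- For every $\mathsf{LTL}_f$ formula $\phi$, the algorithm $\mathsf{CDLSC}$ run on input $\phi$ terminates, and it returns SAT if $\phi$ is satisfiable and UNSAT if $\phi$ is unsatisfiable.
   Context: $\mathsf{LTL}_f$ is linear temporal logic over finite nonempty traces. $Tail$ holds exactly at the last position of a trace. $\mathrm{xnf}(\psi)$ is the neXt normal form of $\psi$ (equivalent to $\psi$, temporal subformulas only under $\mathsf{X}$); $\mathrm{xnf}(s)=\bigwedge_{\psi\in s}\mathrm{xnf}(\psi)$ for a set $s$ of formulas; $\theta^p$ is the propositional abstraction treating each $\mathsf{X}\chi$ (and $Tail$) as a Boolean variable. States are finite sets of formulas; from a satisfying assignment $A$ of a formula containing $\mathrm{xnf}(s)^p$, the next state is $X(A)=\{\chi:\mathsf{X}\chi \text{ true in } A\}$. A state $s$ is final iff $Tail\wedge\mathrm{xnf}(s)^p$ is satisfiable. The algorithm maintains frames $\mathcal{C}[0],\mathcal{C}[1],\ldots$, each a set of finite sets $c$ of formulas; a state $s$ is "in" $\mathcal{C}[i]$ iff $c\subseteq s$ for some $c\in\mathcal{C}[i]$, and $\neg\mathsf{X}(\mathcal{C}[i])$ denotes $\neg\bigvee_{c\in\mathcal{C}[i]}\bigwedge_{\psi\in c}\mathsf{X}\psi$. $get\_uc()$: after an unsatisfiable SAT query of the form $(\mathrm{xnf}(s)\wedge\theta)^p$, returns a subset $c\subseteq s$ (an unsatisfiable core w.r.t. assumption literals, one per $\psi\in s$) such that $(\bigwedge_{\psi\in c}\mathrm{xnf}(\psi)\wedge\theta)^p$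 is still unsatisfiable. Algorithm $\mathsf{CDLSC}(\phi)$: if $Tail\wedge\mathrm{xnf}(\phi)^p$ is satisfiable, return SAT. Otherwise set $\mathcal{C}[0]:=\{\{\phi\}\}$, $k:=0$, and loop: if $try\_satisfy(\phi,k)$ returns true, return SAT; if $inv\_found(k)$ returns true, return UNSAT; set $k:=k+1$ and $\mathcal{C}[k]:=\emptyset$ (frames not yet created are treated as empty). Procedure $try\_satisfy(\psi_0,\ell)$: while $(\neg\mathsf{X}(\mathcal{C}[\ell])\wedge\mathrm{xnf}(\psi_0))^p$ is satisfiable with model $A$: let $\psi'=X(A)$; if $\ell=0$: if $Tail\wedge\mathrm{xnf}(\psi')^p$ is satisfiable return true, else add $get\_uc()$ to $\mathcal{C}[0]$ and continue the loop; if $\ell>0$ and $try\_satisfy(\psi',\ell-1)$ returns true, return true. After the loop exits, add $get\_uc()$ (from the last unsatisfiable query) to $\mathcal{C}[\ell+1]$ and return false. Procedure $inv\_found(k)$: returns true iff for some frame level $i$ the states in all of $\mathcal{C}[0],\ldots,\mathcal{C}[i]$ are all in $\mathcal{C}[i+1]$ (checked as validity of the Boolean implication $\bigwedge_{j\le i}\mathcal{C}[j]\Rightarrow\mathcal{C}[i+1]$). -}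

module Defs where

open import Data.Nat using (ℕ; zero; suc; _≤_; _<_)
open import Data.Bool using (Bool; true; false; not; _∧_; _∨_; if_then_else_)
open import Data.List using (List; []; _∷_; _++_; filterᵇ; foldr; map)
open import Data.List.Relation.Binary.Subset.Propositional using (_⊆_)
open import Data.Maybe using (Maybe; just; nothing)
open import Data.Product using (Σ; _×_; _,_; proj₁)
open import Data.Sum using (_⊎_; inj₁; inj₂)
open import Data.Unit using (⊤)
open import Data.Empty using (⊥)
open import Relation.Binary.PropositionalEquality using (_≡_)
open import Relation.Nullary using (¬_)

-- LTLf syntax (negation normal form; atoms are natural numbers)

data Formula : Set where
  tt ff      : Formula
  atom natom : ℕ → Formula
  _∧ₗ_ _∨ₗ_  : Formula → Formula → Formula
  Xₗ         : Formula → Formula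
  Nₗ         : Formula → Formula
  _Uₗ_ _Rₗ_  : Formula → Formula → Formula

-- Finite nonempty traces: positions 0 .. last, valuation val i p

record Trace : Set where
  field
    last : ℕ
    val  : ℕ → ℕ → Bool
open Trace public

_,_⊨_ : Trace → ℕ → Formula → Set
σ , i ⊨ tt = ⊤
σ , i ⊨ ff = ⊥
σ , i ⊨ atom p = val σ i p ≡ true
σ , i ⊨ natom p = val σ i p ≡ false
σ , i ⊨ (φ ∧ₗ ψ) = (σ , i ⊨ φ) × (σ , i ⊨ ψ)
σ , i ⊨ (φ ∨ₗ ψ) = (σ , i ⊨ φ) ⊎ (σ , i ⊨ ψ)
σ , i ⊨ Xₗ φ = (i < last σ) × (σ , suc i ⊨ φ)
σ , i ⊨ Nₗ φ = i < last σ → σ , suc i ⊨ φ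
σ , i ⊨ (φ Uₗ ψ) = Σ ℕ λ j → i ≤ j × j ≤ last σ × (σ , j ⊨ ψ)
                      × (∀ k → i ≤ k → k < j → σ , k ⊨ φ)
σ , i ⊨ (φ Rₗ ψ) = ∀ j → i ≤ j → j ≤ last σ →
                      (σ , j ⊨ ψ) ⊎ (Σ ℕ λ k → i ≤ k × k < j × (σ , k ⊨ φ))

Satisfiable : Formula → Set
Satisfiable φ = Σ Trace λ σ → σ , 0 ⊨ φ

-- Propositional abstraction: variables are atoms, Tail, and X χ

data Var : Set where
  vatom : ℕ → Var
  vtail : Var
  vnext : Formula → Var

data PForm : Set where
  ptrue pfalse : PForm
  pvar  : Var → PForm
  pnot  : PForm → PForm
  pand por : PForm → PForm → PForm

Assignment : Set
Assignment = Var → Bool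

⟦_⟧ : PForm → Assignment → Bool
⟦ ptrue ⟧ A = true
⟦ pfalse ⟧ A = false
⟦ pvar v ⟧ A = A v
⟦ pnot θ ⟧ A = not (⟦ θ ⟧ A)
⟦ pand θ η ⟧ A = ⟦ θ ⟧ A ∧ ⟦ η ⟧ A
⟦ por θ η ⟧ A = ⟦ θ ⟧ A ∨ ⟦ η ⟧ A

PSat : PForm → Set
PSat θ = Σ Assignment λ A → ⟦ θ ⟧ A ≡ true

PUnsat : PForm → Set
PUnsat θ = ∀ A → ⟦ θ ⟧ A ≡ false

Tail : PForm
Tail = pvar vtail

PX : Formula → PForm
PX χ = pvar (vnext χ)

-- xnf(ψ)^p : the propositional abstraction of the neXt normal form
-- (X χ ≡ ¬Tail ∧ X χ, N χ ≡ Tail ∨ X χ, U/R unfolded once)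
xnfp : Formula → PForm
xnfp tt = ptrue
xnfp ff = pfalse
xnfp (atom p) = pvar (vatom p)
xnfp (natom p) = pnot (pvar (vatom p))
xnfp (φ ∧ₗ ψ) = pand (xnfp φ) (xnfp ψ)
xnfp (φ ∨ₗ ψ) = por (xnfp φ) (xnfp ψ)
xnfp (Xₗ φ) = pand (pnot Tail) (PX φ)
xnfp (Nₗ φ) = por Tail (PX φ)
xnfp (φ Uₗ ψ) = por (xnfp ψ) (pand (xnfp φ) (pand (pnot Tail) (PX (φ Uₗ ψ))))
xnfp (φ Rₗ ψ) = pand (xnfp ψ) (por (xnfp φ) (por Tail (PX (φ Rₗ ψ))))

-- states are finite sets of formulas, represented as lists
State : Set
State = List Formula

xnfS : State → PForm
xnfS s = foldr (λ ψ θ → pand (xnfp ψ) θ) ptrue s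

nexts : PForm → List Formula
nexts ptrue = []
nexts pfalse = []
nexts (pvar (vnext χ)) = χ ∷ []
nexts (pvar _) = []
nexts (pnot θ) = nexts θ
nexts (pand θ η) = nexts θ ++ nexts η
nexts (por θ η) = nexts θ ++ nexts η

-- X(A) = { χ : X χ true in A } (over the X-variables of the query θ)
Xof : PForm → Assignment → State
Xof θ A = filterᵇ (λ χ → A (vnext χ)) (nexts θ)

Frame : Set
Frame = List State

Frames : Set
Frames = List Frame

-- C[i]; frames not yet created are empty
frameAt : Frames → ℕ → Frame
frameAt [] i = []
frameAt (f ∷ C) zero = f
frameAt (f ∷ C) (suc i) = frameAt C i

addTo : Frames → ℕ → State → Frames
addTo [] zero c = (c ∷ []) ∷ []
addTo [] (suc i) c = [] ∷ addTo [] i c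
addTo (f ∷ C) zero c = (c ∷ f) ∷ C
addTo (f ∷ C) (suc i) c = f ∷ addTo C i c

setEmpty : Frames → ℕ → Frames
setEmpty [] zero = [] ∷ []
setEmpty [] (suc i) = [] ∷ setEmpty [] i
setEmpty (f ∷ C) zero = [] ∷ C
setEmpty (f ∷ C) (suc i) = f ∷ setEmpty C i

XFrame : Frame → PForm
XFrame F = foldr (λ c θ → por (foldr (λ ψ η → pand (PX ψ) η) ptrue c) θ) pfalse F

-- SAT oracle: any correct SAT solver (arbitrary choice of model) and
-- any correct unsat-core extractor.

record Oracle : Set where
  field
    solve : (θ : PForm) → PSat θ ⊎ PUnsat θ
    getUC : (s : State) (θ : PForm) → PUnsat (pand (xnfS s) θ) →
            Σ State λ c → c ⊆ s × PUnsat (pand (xnfS c) θ)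

data Result : Set where
  SAT UNSAT : Result

isUnsat : {θ : PForm} → PSat θ ⊎ PUnsat θ → Bool
isUnsat (inj₁ _) = false
isUnsat (inj₂ _) = true

-- The algorithm, run with a fuel bound (nothing = fuel exhausted).

module Algorithm (O : Oracle) where
  open Oracle O

  query : Frames → State → ℕ → PForm
  query C ψ0 ℓ = pand (xnfS ψ0) (pnot (XFrame (frameAt C ℓ)))

  mutual
    trySatisfy : ℕ → Frames → State → ℕ → Maybe (Bool × Frames)
    trySatisfy zero C ψ0 ℓ = nothing
    trySatisfy (suc n) C ψ0 ℓ with solve (query C ψ0 ℓ)
    ... | inj₂ u = just (false , addTo C (suc ℓ) (proj₁ (getUC ψ0 (pnot (XFrame (frameAt C ℓ))) u)))
    ... | inj₁ (A , _) = step n C ψ0 ℓ (Xof (query C ψ0 ℓ) A)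

    step : ℕ → Frames → State → ℕ → State → Maybe (Bool × Frames)
    step n C ψ0 zero ψ' with solve (pand (xnfS ψ') Tail)
    ... | inj₁ _ = just (true , C)
    ... | inj₂ u = trySatisfy n (addTo C zero (proj₁ (getUC ψ' Tail u))) ψ0 zero
    step n C ψ0 (suc ℓ) ψ' with trySatisfy n C ψ' ℓ
    ... | nothing = nothing
    ... | just (true , C') = just (true , C')
    ... | just (false , C') = trySatisfy n C' ψ0 (suc ℓ)

  XUpTo : Frames → ℕ → PForm
  XUpTo C zero = XFrame (frameAt C zero)
  XUpTo C (suc i) = pand (XUpTo C i) (XFrame (frameAt C (suc i)))

  invAt : Frames → ℕ → Bool
  invAt C i = isUnsat {pand (XUpTo C i) (pnot (XFrame (frameAt C (suc i))))} (solve (pand (XUpTo C i) (pnot (XFrame (frameAt C (suc i))))))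

  invFound : Frames → ℕ → Bool
  invFound C zero = invAt C zero
  invFound C (suc k) = invFound C k ∨ invAt C (suc k)

  loop : ℕ → Formula → Frames → ℕ → Maybe Result
  loop zero φ C k = nothing
  loop (suc n) φ C k with trySatisfy n C (φ ∷ []) k
  ... | nothing = nothing
  ... | just (true , C') = just SAT
  ... | just (false , C') =
          if invFound C' k then just UNSAT
          else loop n φ (setEmpty C' (suc k)) (suc k)

  CDLSC : ℕ → Formula → Maybe Result
  CDLSC n φ with solve (pand (xnfS (φ ∷ [])) Tail)
  ... | inj₁ _ = just SAT
  ... | inj₂ _ = loop n φ (((φ ∷ []) ∷ []) ∷ []) zero

open Algorithm public using (CDLSC)

module Submission where

-- Satisfaction is decidable, so each position p of a trace σ
-- induces an assignment (X χ true iff χ holds at p + 1) under which xnf is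
-- complete; conversely a model A of xnf(s) yields a model of s, as a single
-- final position or as A prepended to a model of the successor state X(A).  Clauses of C[0] are never final and clauses of C[ℓ+1] always
-- step into C[ℓ]; every unsat core the algorithm adds keeps this.  So SAT is
-- sound by the model lemmas, and after an UNSAT answer (C[0..i] ⇒ C[i+1])
-- a trace entering C[0..i] could never end.  All formulas involved lie in the subformula closure cl of φ,
-- so an assignment matters only through its pattern, a subset of cl.  Each
-- round of try_satisfy at level ℓ removes a pattern outside C[ℓ], and each
-- failed inv_found check one inside C[0..i]; counting patterns bounds the
-- fuel.

open import Defs
open import Data.Nat using (ℕ; zero; suc; _+_; _*_; _≤_; _<_; z≤n; s≤s)
open import Data.Nat.Properties
open import Data.Bool using (Bool; true; false; not; _∧_; _∨_; T) renaming (_≟_ to _≟ᵇ_)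
open import Data.Bool.Properties using (∨-conicalˡ; ∨-conicalʳ)
open import Data.List using (List; []; _∷_; _++_; filterᵇ; foldr; map; length)
open import Data.List.Properties using (++-assoc; ∷-injectiveˡ; ≡-dec)
open import Relation.Binary.PropositionalEquality
open import Relation.Binary.Definitions using (DecidableEquality)
open import Data.Maybe using (just)
open import Data.Product using (Σ; _×_; _,_; proj₁; proj₂)
import Data.Product as Product
open import Data.Sum using (_⊎_; inj₁; inj₂)
import Data.Sum as Sum
open import Data.Empty using (⊥; ⊥-elim)
open import Data.Unit using (tt)
open import Data.List.Relation.Unary.All using (All; []; _∷_; lookup)
open import Data.List.Relation.Unary.Any using (here; there)
open import Data.List.Membership.Propositional using (_∈_)
open import Data.List.Membership.Propositional.Properties using (∈-++⁺ˡ; ∈-++⁺ʳ; ∈-++⁻; ∈-filter⁺; ∈-filter⁻; ∈-map⁺; ∉[])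
open import Data.List.Relation.Binary.Subset.Propositional using (_⊆_)
open import Data.List.Relation.Binary.Subset.Propositional.Properties using (++⁺)
open import Function using (id; _∘_)
open import Relation.Nullary using (¬_; Dec; yes; no; does)
open import Relation.Nullary.Decidable using (T?; map′; _×-dec_; _⊎-dec_; _→-dec_; dec-true; dec-false)

-- Formulas have decidable equality: the postfix code below is read back
-- by a stack machine, so it is injective.
code : Formula → List ℕ
code tt = 0 ∷ []
code ff = 1 ∷ []
code (atom p) = 2 ∷ p ∷ []
code (natom p) = 3 ∷ p ∷ []
code (φ ∧ₗ ψ) = code φ ++ code ψ ++ 4 ∷ []
code (φ ∨ₗ ψ) = code φ ++ code ψ ++ 5 ∷ []
code (Xₗ φ) = code φ ++ 6 ∷ []
code (Nₗ φ) = code φ ++ 7 ∷ []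
code (φ Uₗ ψ) = code φ ++ code ψ ++ 8 ∷ []
code (φ Rₗ ψ) = code φ ++ code ψ ++ 9 ∷ []

decode : List ℕ → List Formula → List Formula
decode [] st = st
decode (0 ∷ xs) st = decode xs (tt ∷ st)
decode (1 ∷ xs) st = decode xs (ff ∷ st)
decode (2 ∷ p ∷ xs) st = decode xs (atom p ∷ st)
decode (3 ∷ p ∷ xs) st = decode xs (natom p ∷ st)
decode (4 ∷ xs) (ψ ∷ φ ∷ st) = decode xs ((φ ∧ₗ ψ) ∷ st)
decode (5 ∷ xs) (ψ ∷ φ ∷ st) = decode xs ((φ ∨ₗ ψ) ∷ st)
decode (6 ∷ xs) (φ ∷ st) = decode xs (Xₗ φ ∷ st)
decode (7 ∷ xs) (φ ∷ st) = decode xs (Nₗ φ ∷ st)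
decode (8 ∷ xs) (ψ ∷ φ ∷ st) = decode xs ((φ Uₗ ψ) ∷ st)
decode (9 ∷ xs) (ψ ∷ φ ∷ st) = decode xs ((φ Rₗ ψ) ∷ st)
decode _ _ = []

mutual
  decode-code : ∀ φ xs st → decode (code φ ++ xs) st ≡ decode xs (φ ∷ st)
  decode-code tt xs st = refl
  decode-code ff xs st = refl
  decode-code (atom p) xs st = refl
  decode-code (natom p) xs st = refl
  decode-code (φ ∧ₗ ψ) xs st = decode-code₂ φ ψ (4 ∷ []) xs st
  decode-code (φ ∨ₗ ψ) xs st = decode-code₂ φ ψ (5 ∷ []) xs st
  decode-code (Xₗ φ) xs st = decode-code₁ φ (6 ∷ []) xs st
  decode-code (Nₗ φ) xs st = decode-code₁ φ (7 ∷ []) xs st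
  decode-code (φ Uₗ ψ) xs st = decode-code₂ φ ψ (8 ∷ []) xs st
  decode-code (φ Rₗ ψ) xs st = decode-code₂ φ ψ (9 ∷ []) xs st

  decode-code₁ : ∀ φ ys xs st → decode ((code φ ++ ys) ++ xs) st ≡ decode (ys ++ xs) (φ ∷ st)
  decode-code₁ φ ys xs st =
    trans (cong (λ l → decode l st) (++-assoc (code φ) ys xs)) (decode-code φ (ys ++ xs) st)

  decode-code₂ : ∀ φ ψ ys xs st →
                 decode ((code φ ++ code ψ ++ ys) ++ xs) st ≡ decode (ys ++ xs) (ψ ∷ φ ∷ st)
  decode-code₂ φ ψ ys xs st = trans (decode-code₁ φ (code ψ ++ ys) xs st) (decode-code₁ ψ ys xs (φ ∷ st))

code-injective : ∀ {φ ψ} → code φ ≡ code ψ → φ ≡ ψ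
code-injective {φ} {ψ} eq = ∷-injectiveˡ (begin
  φ ∷ []                    ≡⟨ sym (decode-code φ [] []) ⟩
  decode (code φ ++ []) []  ≡⟨ cong (λ l → decode (l ++ []) []) eq ⟩
  decode (code ψ ++ []) []  ≡⟨ decode-code ψ [] [] ⟩
  ψ ∷ []                    ∎)
  where open ≡-Reasoning

_≟F_ : DecidableEquality Formula
φ ≟F ψ = map′ code-injective (cong code) (≡-dec _≟_ (code φ) (code ψ))

∧-split : ∀ {a b} → a ∧ b ≡ true → a ≡ true × b ≡ true
∧-split {true} {true} _ = refl , refl

∧-intro : ∀ {a b} → a ≡ true → b ≡ true → a ∧ b ≡ true
∧-intro refl refl = refl

∨-split : ∀ {a b} → a ∨ b ≡ true → a ≡ true ⊎ b ≡ true
∨-split {true} _ = inj₁ refl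
∨-split {false} e = inj₂ e

∨-introˡ : ∀ {a b} → a ≡ true → a ∨ b ≡ true
∨-introˡ refl = refl

∨-introʳ : ∀ a {b} → b ≡ true → a ∨ b ≡ true
∨-introʳ true _ = refl
∨-introʳ false e = e

not-true : ∀ {a} → not a ≡ true → a ≡ false
not-true {false} _ = refl

not-false : ∀ {a} → a ≡ false → not a ≡ true
not-false refl = refl

∧-not-false : ∀ {a b} → a ≡ true → a ∧ not b ≡ false → b ≡ true
∧-not-false {true} {true} _ _ = refl

true≢false : ∀ {a} → a ≡ true → a ≡ false → ⊥
true≢false refl ()

does-true : ∀ {P : Set} (d : Dec P) → does d ≡ true → P
does-true (yes p) _ = p

not-antitone : ∀ {b b'} → (b ≡ true → b' ≡ true) → not b' ≡ true → not b ≡ true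
not-antitone {false} _ _ = refl
not-antitone {true} h e with h refl
... | refl = e

T⇒≡true : ∀ {b} → T b → b ≡ true
T⇒≡true {true} _ = refl

≡true⇒T : ∀ {b} → b ≡ true → T b
≡true⇒T refl = tt

sub : Formula → List Formula
sub φ = φ ∷ proper φ
  where
  proper : Formula → List Formula
  proper (α ∧ₗ β) = sub α ++ sub β
  proper (α ∨ₗ β) = sub α ++ sub β
  proper (Xₗ α) = sub α
  proper (Nₗ α) = sub α
  proper (α Uₗ β) = sub α ++ sub β
  proper (α Rₗ β) = sub α ++ sub β
  proper _ = []

mutual
  sub-trans : ∀ φ {χ} → χ ∈ sub φ → sub χ ⊆ sub φ
  sub-trans φ (here refl) = id
  sub-trans (φ ∧ₗ ψ) (there k) = there ∘ sub-trans₂ φ ψ k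
  sub-trans (φ ∨ₗ ψ) (there k) = there ∘ sub-trans₂ φ ψ k
  sub-trans (Xₗ φ) (there k) = there ∘ sub-trans φ k
  sub-trans (Nₗ φ) (there k) = there ∘ sub-trans φ k
  sub-trans (φ Uₗ ψ) (there k) = there ∘ sub-trans₂ φ ψ k
  sub-trans (φ Rₗ ψ) (there k) = there ∘ sub-trans₂ φ ψ k

  sub-trans₂ : ∀ φ ψ {χ} → χ ∈ sub φ ++ sub ψ → sub χ ⊆ sub φ ++ sub ψ
  sub-trans₂ φ ψ k with ∈-++⁻ (sub φ) k
  ... | inj₁ k = ∈-++⁺ˡ ∘ sub-trans φ k
  ... | inj₂ k = ∈-++⁺ʳ (sub φ) ∘ sub-trans ψ k

mutual
  -- The X-variables of xnf(χ) are subformulas of χ: the operands of X/N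
  -- and the U/R formula itself.
  nexts-sub : ∀ χ → nexts (xnfp χ) ⊆ sub χ
  nexts-sub (φ ∧ₗ ψ) = there ∘ ++⁺ (nexts-sub φ) (nexts-sub ψ)
  nexts-sub (φ ∨ₗ ψ) = there ∘ ++⁺ (nexts-sub φ) (nexts-sub ψ)
  nexts-sub (Xₗ φ) (here refl) = there (here refl)
  nexts-sub (Nₗ φ) (here refl) = there (here refl)
  nexts-sub (φ Uₗ ψ) = nexts-sub-unfold φ ψ (φ Uₗ ψ)
  nexts-sub (φ Rₗ ψ) = nexts-sub-unfold φ ψ (φ Rₗ ψ)

  nexts-sub-unfold : ∀ φ ψ θ → nexts (xnfp ψ) ++ nexts (xnfp φ) ++ θ ∷ [] ⊆ θ ∷ sub φ ++ sub ψ
  nexts-sub-unfold φ ψ θ m with ∈-++⁻ (nexts (xnfp ψ)) m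
  ... | inj₁ m = there (∈-++⁺ʳ (sub φ) (nexts-sub ψ m))
  ... | inj₂ m with ∈-++⁻ (nexts (xnfp φ)) m
  ...   | inj₁ m = there (∈-++⁺ˡ (nexts-sub φ m))
  ...   | inj₂ (here refl) = here refl

sub-closed : ∀ φ {χ} → χ ∈ sub φ → nexts (xnfp χ) ⊆ sub φ
sub-closed φ k = sub-trans φ k ∘ nexts-sub _

-- Satisfaction at a position is decidable: all quantifiers in the
-- semantics are bounded by the last position of the trace.
_,_⊨?_ : ∀ σ i χ → Dec (σ , i ⊨ χ)
σ , i ⊨? tt = yes tt
σ , i ⊨? ff = no (λ ())
σ , i ⊨? atom p = val σ i p ≟ᵇ true
σ , i ⊨? natom p = val σ i p ≟ᵇ false
σ , i ⊨? (φ ∧ₗ ψ) = (σ , i ⊨? φ) ×-dec (σ , i ⊨? ψ)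
σ , i ⊨? (φ ∨ₗ ψ) = (σ , i ⊨? φ) ⊎-dec (σ , i ⊨? ψ)
σ , i ⊨? Xₗ φ = (i <? last σ) ×-dec (σ , suc i ⊨? φ)
σ , i ⊨? Nₗ φ = (i <? last σ) →-dec (σ , suc i ⊨? φ)
σ , i ⊨? (φ Uₗ ψ) =
  map′ (λ { (j , j<s , i≤j , hψ , hφ) → j , i≤j , ≤-pred j<s , hψ , λ k i≤k k<j → hφ k<j i≤k })
       (λ { (j , i≤j , j≤l , hψ , hφ) → j , s≤s j≤l , i≤j , hψ , λ {k} k<j i≤k → hφ k i≤k k<j })
       (anyUpTo? (λ j → (i ≤? j) ×-dec (σ , j ⊨? ψ) ×-dec
                         allUpTo? (λ k → (i ≤? k) →-dec (σ , k ⊨? φ)) j)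
                 (suc (last σ)))
σ , i ⊨? (φ Rₗ ψ) =
  map′ (λ h j i≤j j≤l → Sum.map₂ (λ { (k , k<j , i≤k , hφ) → k , i≤k , k<j , hφ }) (h (s≤s j≤l) i≤j))
       (λ h {j} j<s i≤j → Sum.map₂ (λ { (k , i≤k , k<j , hφ) → k , k<j , i≤k , hφ }) (h j i≤j (≤-pred j<s)))
       (allUpTo? (λ j → (i ≤? j) →-dec ((σ , j ⊨? ψ) ⊎-dec
                         anyUpTo? (λ k → (i ≤? k) ×-dec (σ , k ⊨? φ)) j))
                 (suc (last σ)))

Holds : Trace → ℕ → State → Set
Holds σ q s = All (σ , q ⊨_) s

traceAsg : Trace → ℕ → Assignment
traceAsg σ p (vatom q) = val σ p q
traceAsg σ p vtail = does (p ≟ last σ)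
traceAsg σ p (vnext χ) = does (σ , suc p ⊨? χ)

traceAsg-next : ∀ σ p χ → σ , suc p ⊨ χ → traceAsg σ p (vnext χ) ≡ true
traceAsg-next σ p χ = dec-true (σ , suc p ⊨? χ)

traceAsg-inner : ∀ σ {p} → p < last σ → traceAsg σ p vtail ≡ false
traceAsg-inner σ {p} p<l = dec-false (p ≟ last σ) (<⇒≢ p<l)

traceAsg-last : ∀ σ → traceAsg σ (last σ) vtail ≡ true
traceAsg-last σ = dec-true (last σ ≟ last σ) refl

traceAsg-step : ∀ σ q c → (∀ {χ} → χ ∈ c → traceAsg σ q (vnext χ) ≡ true) → Holds σ (suc q) c
traceAsg-step σ q [] h = []
traceAsg-step σ q (χ ∷ c) h =
  does-true (σ , suc q ⊨? χ) (h (here refl)) ∷ traceAsg-step σ q c (h ∘ there)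

xnf-complete : ∀ σ p χ → σ , p ⊨ χ → p ≤ last σ → ⟦ xnfp χ ⟧ (traceAsg σ p) ≡ true
xnf-complete σ p tt h _ = refl
xnf-complete σ p (atom q) h _ = h
xnf-complete σ p (natom q) h _ = not-false h
xnf-complete σ p (φ ∧ₗ ψ) (hφ , hψ) pl = ∧-intro (xnf-complete σ p φ hφ pl) (xnf-complete σ p ψ hψ pl)
xnf-complete σ p (φ ∨ₗ ψ) (inj₁ h) pl = ∨-introˡ (xnf-complete σ p φ h pl)
xnf-complete σ p (φ ∨ₗ ψ) (inj₂ h) pl = ∨-introʳ _ (xnf-complete σ p ψ h pl)
xnf-complete σ p (Xₗ φ) (p<l , h) _ = ∧-intro (not-false (traceAsg-inner σ p<l)) (traceAsg-next σ p φ h)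
xnf-complete σ p (Nₗ φ) h pl with m≤n⇒m<n∨m≡n pl
... | inj₁ p<l = ∨-introʳ _ (traceAsg-next σ p φ (h p<l))
... | inj₂ refl = ∨-introˡ (traceAsg-last σ)
xnf-complete σ p (φ Uₗ ψ) (j , p≤j , j≤l , hψ , hφ) pl with p ≟ j
... | yes refl = ∨-introˡ (xnf-complete σ p ψ hψ pl)
... | no p≢j = ∨-introʳ _ (∧-intro (xnf-complete σ p φ (hφ p ≤-refl p<j) pl)
                           (∧-intro (not-false (traceAsg-inner σ (<-≤-trans p<j j≤l)))
                                    (traceAsg-next σ p (φ Uₗ ψ) later)))
  where
  p<j : p < j
  p<j = ≤∧≢⇒< p≤j p≢j
  later : σ , suc p ⊨ (φ Uₗ ψ)
  later = j , p<j , j≤l , hψ , λ k p<k → hφ k (<⇒≤ p<k)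
xnf-complete σ p (φ Rₗ ψ) h pl = ∧-intro (xnf-complete σ p ψ now pl) rest
  where
  now : σ , p ⊨ ψ
  now = Sum.[ id , (λ { (k , p≤k , k<p , _) → ⊥-elim (<-irrefl refl (≤-<-trans p≤k k<p)) }) ]
          (h p ≤-refl pl)
  later : ¬ (σ , p ⊨ φ) → σ , suc p ⊨ (φ Rₗ ψ)
  later ¬φ j p<j j≤l = Sum.map₂ shiftWitness (h j (<⇒≤ p<j) j≤l)
    where
    shiftWitness : Σ ℕ (λ k → p ≤ k × k < j × (σ , k ⊨ φ)) → Σ ℕ (λ k → suc p ≤ k × k < j × (σ , k ⊨ φ))
    shiftWitness (k , p≤k , k<j , hk) with p ≟ k
    ... | yes refl = ⊥-elim (¬φ hk)
    ... | no p≢k = k , ≤∧≢⇒< p≤k p≢k , k<j , hk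
  rest : ⟦ por (xnfp φ) (por Tail (PX (φ Rₗ ψ))) ⟧ (traceAsg σ p) ≡ true
  rest with σ , p ⊨? φ | m≤n⇒m<n∨m≡n pl
  ... | yes hφ | _ = ∨-introˡ (xnf-complete σ p φ hφ pl)
  ... | no ¬φ | inj₂ refl = ∨-introʳ (⟦ xnfp φ ⟧ (traceAsg σ p)) (∨-introˡ (traceAsg-last σ))
  ... | no ¬φ | inj₁ p<l = ∨-introʳ (⟦ xnfp φ ⟧ (traceAsg σ p))
                             (∨-introʳ (traceAsg σ p vtail) (traceAsg-next σ p (φ Rₗ ψ) (later ¬φ)))

xnfS-complete : ∀ σ p s → Holds σ p s → p ≤ last σ → ⟦ xnfS s ⟧ (traceAsg σ p) ≡ true
xnfS-complete σ p [] _ _ = refl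
xnfS-complete σ p (χ ∷ s) (h ∷ hs) pl = ∧-intro (xnf-complete σ p χ h pl) (xnfS-complete σ p s hs pl)

single : Assignment → Trace
single A = record { last = 0 ; val = λ _ q → A (vatom q) }

xnf-sound-final : ∀ A χ → A vtail ≡ true → ⟦ xnfp χ ⟧ A ≡ true → single A , 0 ⊨ χ
xnf-sound-final A tt t e = tt
xnf-sound-final A (atom q) t e = e
xnf-sound-final A (natom q) t e = not-true e
xnf-sound-final A (φ ∧ₗ ψ) t e =
  xnf-sound-final A φ t (proj₁ (∧-split e)) , xnf-sound-final A ψ t (proj₂ (∧-split e))
xnf-sound-final A (φ ∨ₗ ψ) t e = Sum.map (xnf-sound-final A φ t) (xnf-sound-final A ψ t) (∨-split e)
xnf-sound-final A (Xₗ φ) t e = ⊥-elim (true≢false t (not-true (proj₁ (∧-split e))))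
xnf-sound-final A (Nₗ φ) t e = λ ()
xnf-sound-final A (φ Uₗ ψ) t e with ∨-split {⟦ xnfp ψ ⟧ A} e
... | inj₁ now = 0 , z≤n , z≤n , xnf-sound-final A ψ t now , λ _ _ ()
... | inj₂ later = ⊥-elim (true≢false t (not-true (proj₁ (∧-split (proj₂ (∧-split {⟦ xnfp φ ⟧ A} later))))))
xnf-sound-final A (φ Rₗ ψ) t e zero _ _ = inj₁ (xnf-sound-final A ψ t (proj₁ (∧-split e)))

xnfS-sound-final : ∀ A s → A vtail ≡ true → ⟦ xnfS s ⟧ A ≡ true → Holds (single A) 0 s
xnfS-sound-final A [] t e = []
xnfS-sound-final A (χ ∷ s) t e =
  xnf-sound-final A χ t (proj₁ (∧-split e)) ∷ xnfS-sound-final A s t (proj₂ (∧-split {⟦ xnfp χ ⟧ A} e))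

prepend : Assignment → Trace → Trace
prepend A σ = record { last = suc (last σ) ; val = v }
  where
  v : ℕ → ℕ → Bool
  v zero q = A (vatom q)
  v (suc i) q = val σ i q

⊨-prepend : ∀ A σ i χ → σ , i ⊨ χ → prepend A σ , suc i ⊨ χ
⊨-prepend A σ i tt h = tt
⊨-prepend A σ i (atom q) h = h
⊨-prepend A σ i (natom q) h = h
⊨-prepend A σ i (φ ∧ₗ ψ) (hφ , hψ) = ⊨-prepend A σ i φ hφ , ⊨-prepend A σ i ψ hψ
⊨-prepend A σ i (φ ∨ₗ ψ) h = Sum.map (⊨-prepend A σ i φ) (⊨-prepend A σ i ψ) h
⊨-prepend A σ i (Xₗ φ) (i<l , h) = s≤s i<l , ⊨-prepend A σ (suc i) φ h
⊨-prepend A σ i (Nₗ φ) h (s≤s i<l) = ⊨-prepend A σ (suc i) φ (h i<l)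
⊨-prepend A σ i (φ Uₗ ψ) (j , i≤j , j≤l , hψ , hφ) =
  suc j , s≤s i≤j , s≤s j≤l , ⊨-prepend A σ j ψ hψ ,
  λ { (suc k) (s≤s i≤k) (s≤s k<j) → ⊨-prepend A σ k φ (hφ k i≤k k<j) }
⊨-prepend A σ i (φ Rₗ ψ) h (suc j) (s≤s i≤j) (s≤s j≤l) =
  Sum.map (⊨-prepend A σ j ψ)
          (λ { (k , i≤k , k<j , hk) → suc k , s≤s i≤k , s≤s k<j , ⊨-prepend A σ k φ hk })
          (h j i≤j j≤l)

U-expand : ∀ σ i φ ψ → (σ , i ⊨ ψ) ⊎ ((σ , i ⊨ φ) × (σ , suc i ⊨ (φ Uₗ ψ))) → i ≤ last σ →
           σ , i ⊨ (φ Uₗ ψ)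
U-expand σ i φ ψ (inj₁ hψ) i≤l = i , ≤-refl , i≤l , hψ , λ k i≤k k<i → ⊥-elim (<-irrefl refl (≤-<-trans i≤k k<i))
U-expand σ i φ ψ (inj₂ (hφ , j , i<j , j≤l , hψ , hφ')) _ = j , <⇒≤ i<j , j≤l , hψ , until
  where
  until : ∀ k → i ≤ k → k < j → σ , k ⊨ φ
  until k i≤k k<j with i ≟ k
  ... | yes refl = hφ
  ... | no i≢k = hφ' k (≤∧≢⇒< i≤k i≢k) k<j

R-expand : ∀ σ i φ ψ → σ , i ⊨ ψ → (σ , i ⊨ φ) ⊎ (σ , suc i ⊨ (φ Rₗ ψ)) → σ , i ⊨ (φ Rₗ ψ)
R-expand σ i φ ψ hψ released j i≤j j≤l with i ≟ j
... | yes refl = inj₁ hψ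
... | no i≢j with released
...   | inj₁ hφ = inj₂ (i , ≤-refl , ≤∧≢⇒< i≤j i≢j , hφ)
...   | inj₂ h = Sum.map₂ (λ { (k , i<k , k<j , hk) → k , <⇒≤ i<k , k<j , hk }) (h j (≤∧≢⇒< i≤j i≢j) j≤l)

xnf-sound-step : ∀ A σ χ → A vtail ≡ false →
                 (∀ {ψ} → ψ ∈ nexts (xnfp χ) → A (vnext ψ) ≡ true → σ , 0 ⊨ ψ) →
                 ⟦ xnfp χ ⟧ A ≡ true → prepend A σ , 0 ⊨ χ
xnf-sound-step A σ tt t H e = tt
xnf-sound-step A σ (atom q) t H e = e
xnf-sound-step A σ (natom q) t H e = not-true e
xnf-sound-step A σ (φ ∧ₗ ψ) t H e =
  xnf-sound-step A σ φ t (H ∘ ∈-++⁺ˡ) (proj₁ (∧-split e)) ,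
  xnf-sound-step A σ ψ t (H ∘ ∈-++⁺ʳ _) (proj₂ (∧-split {⟦ xnfp φ ⟧ A} e))
xnf-sound-step A σ (φ ∨ₗ ψ) t H e =
  Sum.map (xnf-sound-step A σ φ t (H ∘ ∈-++⁺ˡ)) (xnf-sound-step A σ ψ t (H ∘ ∈-++⁺ʳ _)) (∨-split e)
xnf-sound-step A σ (Xₗ φ) t H e = s≤s z≤n , ⊨-prepend A σ 0 φ (H (here refl) (proj₂ (∧-split e)))
xnf-sound-step A σ (Nₗ φ) t H e _ with ∨-split {A vtail} e
... | inj₁ tail = ⊥-elim (true≢false tail t)
... | inj₂ next = ⊨-prepend A σ 0 φ (H (here refl) next)
xnf-sound-step A σ (φ Uₗ ψ) t H e =
  U-expand (prepend A σ) 0 φ ψ (Sum.map now later (∨-split {⟦ xnfp ψ ⟧ A} e)) z≤n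
  where
  now : ⟦ xnfp ψ ⟧ A ≡ true → prepend A σ , 0 ⊨ ψ
  now = xnf-sound-step A σ ψ t (H ∘ ∈-++⁺ˡ)
  later : ⟦ pand (xnfp φ) (pand (pnot Tail) (PX (φ Uₗ ψ))) ⟧ A ≡ true →
          (prepend A σ , 0 ⊨ φ) × (prepend A σ , 1 ⊨ (φ Uₗ ψ))
  later e' = xnf-sound-step A σ φ t (H ∘ ∈-++⁺ʳ (nexts (xnfp ψ)) ∘ ∈-++⁺ˡ) (proj₁ (∧-split e')) ,
             ⊨-prepend A σ 0 (φ Uₗ ψ)
               (H (∈-++⁺ʳ (nexts (xnfp ψ)) (∈-++⁺ʳ (nexts (xnfp φ)) (here refl)))
                  (proj₂ (∧-split {not (A vtail)} (proj₂ (∧-split {⟦ xnfp φ ⟧ A} e')))))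
xnf-sound-step A σ (φ Rₗ ψ) t H e =
  R-expand (prepend A σ) 0 φ ψ (xnf-sound-step A σ ψ t (H ∘ ∈-++⁺ˡ) (proj₁ (∧-split e)))
    (Sum.map now later (∨-split {⟦ xnfp φ ⟧ A} (proj₂ (∧-split e))))
  where
  now : ⟦ xnfp φ ⟧ A ≡ true → prepend A σ , 0 ⊨ φ
  now = xnf-sound-step A σ φ t (H ∘ ∈-++⁺ʳ (nexts (xnfp ψ)) ∘ ∈-++⁺ˡ)
  later : ⟦ por Tail (PX (φ Rₗ ψ)) ⟧ A ≡ true → prepend A σ , 1 ⊨ (φ Rₗ ψ)
  later e' with ∨-split {A vtail} e'
  ... | inj₁ tail = ⊥-elim (true≢false tail t)
  ... | inj₂ next = ⊨-prepend A σ 0 (φ Rₗ ψ)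
                      (H (∈-++⁺ʳ (nexts (xnfp ψ)) (∈-++⁺ʳ (nexts (xnfp φ)) (here refl))) next)

xnfS-sound-step : ∀ A σ s → A vtail ≡ false →
                  (∀ {ψ} → ψ ∈ nexts (xnfS s) → A (vnext ψ) ≡ true → σ , 0 ⊨ ψ) →
                  ⟦ xnfS s ⟧ A ≡ true → Holds (prepend A σ) 0 s
xnfS-sound-step A σ [] t H e = []
xnfS-sound-step A σ (χ ∷ s) t H e =
  xnf-sound-step A σ χ t (H ∘ ∈-++⁺ˡ) (proj₁ (∧-split e)) ∷
  xnfS-sound-step A σ s t (H ∘ ∈-++⁺ʳ (nexts (xnfp χ))) (proj₂ (∧-split {⟦ xnfp χ ⟧ A} e))

∈-Xof⁺ : ∀ θ A {χ} → χ ∈ nexts θ → A (vnext χ) ≡ true → χ ∈ Xof θ A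
∈-Xof⁺ θ A m e = ∈-filter⁺ (T? ∘ λ χ → A (vnext χ)) m (≡true⇒T e)

∈-Xof⁻ : ∀ θ A {χ} → χ ∈ Xof θ A → χ ∈ nexts θ × A (vnext χ) ≡ true
∈-Xof⁻ θ A m = Product.map₂ T⇒≡true (∈-filter⁻ (T? ∘ λ χ → A (vnext χ)) m)

SatState : State → Set
SatState s = Σ Trace λ σ → Holds σ 0 s

final-sat : ∀ s A → ⟦ pand (xnfS s) Tail ⟧ A ≡ true → SatState s
final-sat s A e = single A , xnfS-sound-final A s (proj₂ (∧-split {⟦ xnfS s ⟧ A} e)) (proj₁ (∧-split e))

step-sat : ∀ s η A → ⟦ pand (xnfS s) η ⟧ A ≡ true →
           (A vtail ≡ false → SatState (Xof (pand (xnfS s) η) A)) → SatState s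
step-sat s η A e next with A vtail in tail
... | true = single A , xnfS-sound-final A s tail (proj₁ (∧-split e))
... | false with next refl
...   | (σ , hσ) = prepend A σ , xnfS-sound-step A σ s tail successor (proj₁ (∧-split e))
  where
  successor : ∀ {ψ} → ψ ∈ nexts (xnfS s) → A (vnext ψ) ≡ true → σ , 0 ⊨ ψ
  successor m set = lookup hσ (∈-Xof⁺ (pand (xnfS s) η) A (∈-++⁺ˡ m) set)

unsat-final : ∀ s → PUnsat (pand (xnfS s) Tail) → ∀ σ → ¬ Holds σ (last σ) s
unsat-final s u σ hs =
  true≢false (∧-intro (xnfS-complete σ (last σ) s hs ≤-refl) (traceAsg-last σ)) (u (traceAsg σ (last σ)))

unsat-entails : ∀ s θ → PUnsat (pand (xnfS s) (pnot θ)) →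
                ∀ σ q → q ≤ last σ → Holds σ q s → ⟦ θ ⟧ (traceAsg σ q) ≡ true
unsat-entails s θ u σ q ql hs = ∧-not-false (xnfS-complete σ q s hs ql) (u (traceAsg σ q))

XClause : State → PForm
XClause c = foldr (λ ψ η → pand (PX ψ) η) ptrue c

Sets : Assignment → State → Set
Sets A c = ∀ {χ} → χ ∈ c → A (vnext χ) ≡ true

XClause-true⁻ : ∀ c A → ⟦ XClause c ⟧ A ≡ true → Sets A c
XClause-true⁻ (χ ∷ c) A e (here refl) = proj₁ (∧-split e)
XClause-true⁻ (χ ∷ c) A e (there m) = XClause-true⁻ c A (proj₂ (∧-split {A (vnext χ)} e)) m

XClause-true⁺ : ∀ c A → Sets A c → ⟦ XClause c ⟧ A ≡ true
XClause-true⁺ [] A h = refl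
XClause-true⁺ (χ ∷ c) A h = ∧-intro (h (here refl)) (XClause-true⁺ c A (h ∘ there))

XFrame-true⁻ : ∀ F A → ⟦ XFrame F ⟧ A ≡ true → Σ State λ c → c ∈ F × Sets A c
XFrame-true⁻ (c ∷ F) A e with ∨-split {⟦ XClause c ⟧ A} e
... | inj₁ now = c , here refl , XClause-true⁻ c A now
... | inj₂ rest with XFrame-true⁻ F A rest
...   | (c' , m , h) = c' , there m , h

XFrame-true⁺ : ∀ F A {c} → c ∈ F → Sets A c → ⟦ XFrame F ⟧ A ≡ true
XFrame-true⁺ (c ∷ F) A (here refl) h = ∨-introˡ (XClause-true⁺ c A h)
XFrame-true⁺ (c' ∷ F) A (there m) h = ∨-introʳ (⟦ XClause c' ⟧ A) (XFrame-true⁺ F A m h)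

XFrame-mono : ∀ F F' A → F ⊆ F' → ⟦ XFrame F ⟧ A ≡ true → ⟦ XFrame F' ⟧ A ≡ true
XFrame-mono F F' A sub e with XFrame-true⁻ F A e
... | (c , m , h) = XFrame-true⁺ F' A (sub m) h

XFrame-ext : ∀ F A B → (∀ {c χ} → c ∈ F → χ ∈ c → A (vnext χ) ≡ B (vnext χ)) →
             ⟦ XFrame F ⟧ A ≡ ⟦ XFrame F ⟧ B
XFrame-ext [] A B h = refl
XFrame-ext (c ∷ F) A B h = cong₂ _∨_ (clause c (h (here refl))) (XFrame-ext F A B (h ∘ there))
  where
  clause : ∀ c → (∀ {χ} → χ ∈ c → A (vnext χ) ≡ B (vnext χ)) → ⟦ XClause c ⟧ A ≡ ⟦ XClause c ⟧ B
  clause [] _ = refl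
  clause (χ ∷ c) hc = cong₂ _∧_ (hc (here refl)) (clause c (hc ∘ there))

XFrame-nexts⁻ : ∀ F {χ} → χ ∈ nexts (XFrame F) → Σ State λ c → c ∈ F × χ ∈ c
XFrame-nexts⁻ (c ∷ F) m with ∈-++⁻ (nexts (XClause c)) m
... | inj₁ m = c , here refl , clause c m
  where
  clause : ∀ c {χ} → χ ∈ nexts (XClause c) → χ ∈ c
  clause (ψ ∷ c) (here refl) = here refl
  clause (ψ ∷ c) (there m) = there (clause c m)
... | inj₂ m with XFrame-nexts⁻ F m
...   | (c' , m' , h) = c' , there m' , h

xnfS-nexts⁻ : ∀ s {χ} → χ ∈ nexts (xnfS s) → Σ Formula λ ψ → ψ ∈ s × χ ∈ nexts (xnfp ψ)
xnfS-nexts⁻ (ψ ∷ s) m with ∈-++⁻ (nexts (xnfp ψ)) m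
... | inj₁ m = ψ , here refl , m
... | inj₂ m with xnfS-nexts⁻ s m
...   | (ψ' , m' , h) = ψ' , there m' , h

frameAt-addTo-same : ∀ C i c → frameAt (addTo C i c) i ≡ c ∷ frameAt C i
frameAt-addTo-same [] zero c = refl
frameAt-addTo-same [] (suc i) c = frameAt-addTo-same [] i c
frameAt-addTo-same (f ∷ C) zero c = refl
frameAt-addTo-same (f ∷ C) (suc i) c = frameAt-addTo-same C i c

frameAt-addTo-other : ∀ C {i j} c → i ≢ j → frameAt (addTo C i c) j ≡ frameAt C j
frameAt-addTo-other [] {zero} {zero} c ne = ⊥-elim (ne refl)
frameAt-addTo-other [] {zero} {suc j} c ne = refl
frameAt-addTo-other [] {suc i} {zero} c ne = refl
frameAt-addTo-other [] {suc i} {suc j} c ne = frameAt-addTo-other [] c (ne ∘ cong suc)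
frameAt-addTo-other (f ∷ C) {zero} {zero} c ne = ⊥-elim (ne refl)
frameAt-addTo-other (f ∷ C) {zero} {suc j} c ne = refl
frameAt-addTo-other (f ∷ C) {suc i} {zero} c ne = refl
frameAt-addTo-other (f ∷ C) {suc i} {suc j} c ne = frameAt-addTo-other C c (ne ∘ cong suc)

frameAt-setEmpty-same : ∀ C i → frameAt (setEmpty C i) i ≡ []
frameAt-setEmpty-same [] zero = refl
frameAt-setEmpty-same [] (suc i) = frameAt-setEmpty-same [] i
frameAt-setEmpty-same (f ∷ C) zero = refl
frameAt-setEmpty-same (f ∷ C) (suc i) = frameAt-setEmpty-same C i

frameAt-setEmpty-other : ∀ C {i j} → i ≢ j → frameAt (setEmpty C i) j ≡ frameAt C j
frameAt-setEmpty-other [] {zero} {zero} ne = ⊥-elim (ne refl)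
frameAt-setEmpty-other [] {zero} {suc j} ne = refl
frameAt-setEmpty-other [] {suc i} {zero} ne = refl
frameAt-setEmpty-other [] {suc i} {suc j} ne = frameAt-setEmpty-other [] (ne ∘ cong suc)
frameAt-setEmpty-other (f ∷ C) {zero} {zero} ne = ⊥-elim (ne refl)
frameAt-setEmpty-other (f ∷ C) {zero} {suc j} ne = refl
frameAt-setEmpty-other (f ∷ C) {suc i} {zero} ne = refl
frameAt-setEmpty-other (f ∷ C) {suc i} {suc j} ne = frameAt-setEmpty-other C (ne ∘ cong suc)

∈-addTo⁻ : ∀ C i c {j x} → x ∈ frameAt (addTo C i c) j → (i ≡ j × x ≡ c) ⊎ x ∈ frameAt C j
∈-addTo⁻ C i c {j} {x} m with i ≟ j
... | no ne = inj₂ (subst (x ∈_) (frameAt-addTo-other C c ne) m)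
... | yes refl with subst (x ∈_) (frameAt-addTo-same C i c) m
...   | here e = inj₁ (refl , e)
...   | there m' = inj₂ m'

∈-addTo-same : ∀ C i c → c ∈ frameAt (addTo C i c) i
∈-addTo-same C i c = subst (c ∈_) (sym (frameAt-addTo-same C i c)) (here refl)

_⊑_ : Frames → Frames → Set
C ⊑ C' = ∀ j → frameAt C j ⊆ frameAt C' j

⊑-refl : ∀ {C} → C ⊑ C
⊑-refl j m = m

⊑-trans : ∀ {C D E} → C ⊑ D → D ⊑ E → C ⊑ E
⊑-trans C⊑D D⊑E j = D⊑E j ∘ C⊑D j

⊑-addTo : ∀ C i c → C ⊑ addTo C i c
⊑-addTo C i c j {x} m with i ≟ j
... | yes refl = subst (x ∈_) (sym (frameAt-addTo-same C i c)) (there m)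
... | no ne = subst (x ∈_) (sym (frameAt-addTo-other C c ne)) m

count : ∀ {A : Set} → (A → Bool) → List A → ℕ
count P [] = 0
count P (x ∷ xs) with P x
... | true = suc (count P xs)
... | false = count P xs

count≤length : ∀ {A : Set} (P : A → Bool) xs → count P xs ≤ length xs
count≤length P [] = z≤n
count≤length P (x ∷ xs) with P x
... | true = s≤s (count≤length P xs)
... | false = m≤n⇒m≤1+n (count≤length P xs)

count-mono : ∀ {A : Set} (P Q : A → Bool) → (∀ x → Q x ≡ true → P x ≡ true) →
             ∀ xs → count Q xs ≤ count P xs
count-mono P Q Q⇒P [] = z≤n
count-mono P Q Q⇒P (x ∷ xs) with Q x in q | P x in p
... | true | true = s≤s (count-mono P Q Q⇒P xs)
... | true | false = ⊥-elim (true≢false (Q⇒P x q) p)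
... | false | true = m≤n⇒m≤1+n (count-mono P Q Q⇒P xs)
... | false | false = count-mono P Q Q⇒P xs

count-strict : ∀ {A : Set} (P Q : A → Bool) → (∀ x → Q x ≡ true → P x ≡ true) →
               ∀ xs {w} → w ∈ xs → P w ≡ true → Q w ≡ false → count Q xs < count P xs
count-strict P Q Q⇒P (x ∷ xs) (here refl) pw qw with Q x | P x
... | false | true = s≤s (count-mono P Q Q⇒P xs)
count-strict P Q Q⇒P (x ∷ xs) (there m) pw qw with Q x in q | P x in p
... | true | true = s≤s (count-strict P Q Q⇒P xs m pw qw)
... | true | false = ⊥-elim (true≢false (Q⇒P x q) p)
... | false | true = m<n⇒m<1+n (count-strict P Q Q⇒P xs m pw qw)
... | false | false = count-strict P Q Q⇒P xs m pw qw

sublists : ∀ {A : Set} → List A → List (List A)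
sublists [] = [] ∷ []
sublists (x ∷ xs) = map (x ∷_) (sublists xs) ++ sublists xs

filterᵇ∈sublists : ∀ {A : Set} (p : A → Bool) xs → filterᵇ p xs ∈ sublists xs
filterᵇ∈sublists p [] = here refl
filterᵇ∈sublists p (x ∷ xs) with p x
... | true = ∈-++⁺ˡ (∈-map⁺ (x ∷_) (filterᵇ∈sublists p xs))
... | false = ∈-++⁺ʳ (map (x ∷_) (sublists xs)) (filterᵇ∈sublists p xs)

-- A finite abstraction of assignments relative to a list cl of formulas:
-- the pattern of A is the set of χ ∈ cl whose X-variable A sets.
module Patterns (cl : List Formula) where
  open import Data.List.Membership.DecPropositional _≟F_ using (_∈?_)

  patterns : List State
  patterns = sublists cl

  patternOf : Assignment → State
  patternOf A = filterᵇ (λ χ → A (vnext χ)) cl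

  patternOf∈patterns : ∀ A → patternOf A ∈ patterns
  patternOf∈patterns A = filterᵇ∈sublists (λ χ → A (vnext χ)) cl

  patternAsg : State → Assignment
  patternAsg S (vnext χ) = does (χ ∈? S)
  patternAsg S _ = false

  patternAsg-patternOf : ∀ A {χ} → χ ∈ cl → patternAsg (patternOf A) (vnext χ) ≡ A (vnext χ)
  patternAsg-patternOf A {χ} χ∈cl with A (vnext χ) in set
  ... | true = dec-true (χ ∈? patternOf A) (∈-filter⁺ (T? ∘ λ χ → A (vnext χ)) χ∈cl (≡true⇒T set))
  ... | false = dec-false (χ ∈? patternOf A)
                  (λ m → true≢false (T⇒≡true (proj₂ (∈-filter⁻ (T? ∘ λ χ → A (vnext χ)) {xs = cl} m))) set)

  Local : PForm → Set
  Local θ = ∀ A → ⟦ θ ⟧ (patternAsg (patternOf A)) ≡ ⟦ θ ⟧ A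

  FrameInCl : Frame → Set
  FrameInCl F = ∀ {c χ} → c ∈ F → χ ∈ c → χ ∈ cl

  XFrame-local : ∀ F → FrameInCl F → Local (XFrame F)
  XFrame-local F inCl A = XFrame-ext F _ A (λ mc mχ → patternAsg-patternOf A (inCl mc mχ))

  models : PForm → ℕ
  models θ = count (λ S → ⟦ θ ⟧ (patternAsg S)) patterns

  models≤ : ∀ θ → models θ ≤ length patterns
  models≤ θ = count≤length _ patterns

  -- The counting argument behind termination: if θ' implies θ on
  -- patterns, and some assignment satisfies θ but not θ', then θ' has
  -- strictly fewer models.
  fewer-models : ∀ θ θ' → Local θ → Local θ' →
                 (∀ S → ⟦ θ' ⟧ (patternAsg S) ≡ true → ⟦ θ ⟧ (patternAsg S) ≡ true) →
                 ∀ A → ⟦ θ ⟧ A ≡ true → ⟦ θ' ⟧ A ≡ false → models θ' < models θ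
  fewer-models θ θ' loc loc' θ'⇒θ A θ-true θ'-false =
    count-strict _ _ θ'⇒θ patterns (patternOf∈patterns A) (trans (loc A) θ-true) (trans (loc' A) θ'-false)

StepsInto : State → Frame → Set
StepsInto c F = ∀ σ q → q ≤ last σ → Holds σ q c → ⟦ XFrame F ⟧ (traceAsg σ q) ≡ true

StepsInto-mono : ∀ {c F F'} → F ⊆ F' → StepsInto c F → StepsInto c F'
StepsInto-mono {F = F} {F'} F⊆F' h σ q ql hs = XFrame-mono F F' (traceAsg σ q) F⊆F' (h σ q ql hs)

-- What the algorithm's frames mean: a clause of C[0] is never final, and
-- a clause of C[ℓ+1] always steps into C[ℓ].  Hence no state in C[i]
-- reaches the end of a trace within i steps.
Justified : Frames → ℕ → State → Set
Justified C zero c = ∀ σ → ¬ Holds σ (last σ) c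
Justified C (suc ℓ) c = StepsInto c (frameAt C ℓ)

Justified-mono : ∀ {C C'} i {c} → C ⊑ C' → Justified C i c → Justified C' i c
Justified-mono zero C⊑C' = id
Justified-mono (suc ℓ) C⊑C' = StepsInto-mono (C⊑C' ℓ)

Correct : Result → Formula → Set
Correct SAT φ = Satisfiable φ
Correct UNSAT φ = ¬ Satisfiable φ

satisfiable : ∀ {φ} → SatState (φ ∷ []) → Satisfiable φ
satisfiable (σ , h ∷ []) = σ , h

correct-answer : ∀ r φ → Correct r φ → (Satisfiable φ → r ≡ SAT) × (¬ Satisfiable φ → r ≡ UNSAT)
correct-answer SAT φ sat = (λ _ → refl) , (λ unsat → ⊥-elim (unsat sat))
correct-answer UNSAT φ unsat = (λ sat → ⊥-elim (unsat sat)) , (λ _ → refl)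

module Correctness (O : Oracle) (cl : List Formula)
                   (closed : ∀ {χ} → χ ∈ cl → nexts (xnfp χ) ⊆ cl) where
  open Oracle O
  open Algorithm O hiding (CDLSC)
  open Patterns cl

  record Invariant (C : Frames) : Set where
    field
      inCl : ∀ j → FrameInCl (frameAt C j)
      justified : ∀ i {c} → c ∈ frameAt C i → Justified C i c
  open Invariant

  inv-addTo : ∀ C i c → Invariant C → c ⊆ cl → Justified C i c → Invariant (addTo C i c)
  inv-addTo C i c I c⊆cl c-justified = record { inCl = inCl' ; justified = justified' }
    where
    inCl' : ∀ j → FrameInCl (frameAt (addTo C i c) j)
    inCl' j m mχ with ∈-addTo⁻ C i c m
    ... | inj₁ (_ , refl) = c⊆cl mχ
    ... | inj₂ m' = inCl I j m' mχ
    justified' : ∀ j {c'} → c' ∈ frameAt (addTo C i c) j → Justified (addTo C i c) j c'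
    justified' j m with ∈-addTo⁻ C i c m
    ... | inj₁ (refl , refl) = Justified-mono i (⊑-addTo C i c) c-justified
    ... | inj₂ m' = Justified-mono j (⊑-addTo C i c) (justified I j m')

  inv-setEmpty : ∀ C i → Invariant C → frameAt C (suc i) ≡ [] → Invariant (setEmpty C i)
  inv-setEmpty C i I above = record { inCl = λ j m → inCl I j (kept j m) ; justified = justified' }
    where
    kept : ∀ j {c} → c ∈ frameAt (setEmpty C i) j → c ∈ frameAt C j
    kept j {c} m with i ≟ j
    ... | yes refl = ⊥-elim (∉[] (subst (c ∈_) (frameAt-setEmpty-same C i) m))
    ... | no i≢j = subst (c ∈_) (frameAt-setEmpty-other C i≢j) m
    justified' : ∀ j {c} → c ∈ frameAt (setEmpty C i) j → Justified (setEmpty C i) j c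
    justified' zero m = justified I zero (kept zero m)
    justified' (suc ℓ) {c} m with i ≟ ℓ
    ... | yes refl = ⊥-elim (∉[] (subst (c ∈_) above (kept (suc i) m)))
    ... | no i≢ℓ = subst (StepsInto c) (sym (frameAt-setEmpty-other C i≢ℓ))
                         (justified I (suc ℓ) (kept (suc ℓ) m))

  Outcome : Bool → State → ℕ → Frames → Set
  Outcome true ψ0 ℓ C' = SatState ψ0
  Outcome false ψ0 ℓ C' = StepsInto ψ0 (frameAt C' ℓ) × Σ State λ c → c ∈ frameAt C' (suc ℓ) × c ⊆ ψ0

  record Run (C : Frames) (ψ0 : State) (ℓ : ℕ) (b : Bool) (C' : Frames) : Set where
    field
      grows : C ⊑ C'
      invariant : Invariant C'
      unchangedAbove : ∀ j → suc ℓ < j → frameAt C' j ≡ frameAt C j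
      outcome : Outcome b ψ0 ℓ C'
  open Run

  Run-after : ∀ {C C' ψ0 ℓ b C''} → C ⊑ C' → (∀ j → suc ℓ < j → frameAt C' j ≡ frameAt C j) →
              Run C' ψ0 ℓ b C'' → Run C ψ0 ℓ b C''
  Run-after {C} {C'} {C'' = C''} C⊑C' same r = record
    { grows = ⊑-trans {C} {C'} {C''} C⊑C' (grows r) ; invariant = invariant r
    ; unchangedAbove = λ j lt → trans (unchangedAbove r j lt) (same j lt) ; outcome = outcome r }

  successor-inCl : ∀ C ψ0 ℓ A → Invariant C → ψ0 ⊆ cl → Xof (query C ψ0 ℓ) A ⊆ cl
  successor-inCl C ψ0 ℓ A I ψ0⊆cl m with ∈-++⁻ (nexts (xnfS ψ0)) (proj₁ (∈-Xof⁻ (query C ψ0 ℓ) A m))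
  ... | inj₁ m' with xnfS-nexts⁻ ψ0 m'
  ...   | (ψ , mψ , mχ) = closed (ψ0⊆cl mψ) mχ
  successor-inCl C ψ0 ℓ A I ψ0⊆cl m | inj₂ m' with XFrame-nexts⁻ (frameAt C ℓ) m'
  ...   | (c , mc , mχ) = inCl I ℓ mc mχ

  -- The termination measure of level ℓ: the patterns not yet in C[ℓ].
  outside : Frames → ℕ → ℕ
  outside C ℓ = models (pnot (XFrame (frameAt C ℓ)))

  outside-decreases : ∀ C C' ψ0 ℓ A → Invariant C → Invariant C' → C ⊑ C' →
                      ⟦ query C ψ0 ℓ ⟧ A ≡ true →
                      (Σ State λ c → c ∈ frameAt C' ℓ × c ⊆ Xof (query C ψ0 ℓ) A) →
                      outside C' ℓ < outside C ℓ
  outside-decreases C C' ψ0 ℓ A I I' C⊑C' model (c , mc , c⊆X) =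
    fewer-models (pnot (XFrame F)) (pnot (XFrame F'))
      (λ B → cong not (XFrame-local F (inCl I ℓ) B)) (λ B → cong not (XFrame-local F' (inCl I' ℓ) B))
      (λ S → not-antitone (XFrame-mono F F' (patternAsg S) (C⊑C' ℓ)))
      A (proj₂ (∧-split model))
      (cong not (XFrame-true⁺ F' A mc (λ mχ → proj₂ (∈-Xof⁻ (query C ψ0 ℓ) A (c⊆X mχ)))))
    where
    F F' : Frame
    F = frameAt C ℓ
    F' = frameAt C' ℓ

  N : ℕ
  N = length patterns

  K : ℕ
  K = suc N

  -- Fuel needed by try_satisfy at level ℓ: its own measure plus K for
  -- every level below (each level's measure is at most N).
  budget : Frames → ℕ → ℕ
  budget C ℓ = outside C ℓ + ℓ * K

  budget-descend : ∀ C C' ℓ n → budget C (suc ℓ) < suc n → budget C' ℓ < n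
  budget-descend C C' ℓ n lt =
    ≤-trans (s≤s (+-monoˡ-≤ (ℓ * K) (models≤ (pnot (XFrame (frameAt C' ℓ))))))
            (≤-trans (m≤n+m (K + ℓ * K) (outside C (suc ℓ))) (≤-pred lt))

  budget-retry : ∀ C C' ℓ n → outside C' ℓ < outside C ℓ → budget C ℓ < suc n → budget C' ℓ < n
  budget-retry C C' ℓ n dec lt = ≤-trans (+-monoˡ-≤ (ℓ * K) dec) (≤-pred lt)

  TryResult : ℕ → Frames → State → ℕ → Set
  TryResult n C ψ0 ℓ = Σ Bool λ b → Σ Frames λ C' → trySatisfy n C ψ0 ℓ ≡ just (b , C') × Run C ψ0 ℓ b C'

  StepResult : ℕ → Frames → State → ℕ → Assignment → Set
  StepResult n C ψ0 ℓ A =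
    Σ Bool λ b → Σ Frames λ C' → step n C ψ0 ℓ (Xof (query C ψ0 ℓ) A) ≡ just (b , C') × Run C ψ0 ℓ b C'

  blockingCore : ∀ C ψ0 ℓ → PUnsat (query C ψ0 ℓ) → State
  blockingCore C ψ0 ℓ u = proj₁ (getUC ψ0 (pnot (XFrame (frameAt C ℓ))) u)

  run-blocked : ∀ C ψ0 ℓ → Invariant C → ψ0 ⊆ cl → (u : PUnsat (query C ψ0 ℓ)) →
                Run C ψ0 ℓ false (addTo C (suc ℓ) (blockingCore C ψ0 ℓ u))
  run-blocked C ψ0 ℓ I ψ0⊆cl u with getUC ψ0 (pnot (XFrame (frameAt C ℓ))) u
  ... | (c , c⊆ψ0 , c-unsat) = record
    { grows = ⊑-addTo C (suc ℓ) c
    ; invariant = inv-addTo C (suc ℓ) c I (ψ0⊆cl ∘ c⊆ψ0) (unsat-entails c (XFrame (frameAt C ℓ)) c-unsat)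
    ; unchangedAbove = λ j lt → frameAt-addTo-other C c (<⇒≢ lt)
    ; outcome = StepsInto-mono (⊑-addTo C (suc ℓ) c ℓ) (unsat-entails ψ0 (XFrame (frameAt C ℓ)) u) ,
                c , ∈-addTo-same C (suc ℓ) c , c⊆ψ0 }

  mutual
    trySatisfy-run : ∀ n C ψ0 ℓ → Invariant C → ψ0 ⊆ cl → budget C ℓ < n → TryResult n C ψ0 ℓ
    trySatisfy-run (suc n) C ψ0 ℓ I ψ0⊆cl bud with solve (query C ψ0 ℓ)
    ... | inj₂ u = false , _ , refl , run-blocked C ψ0 ℓ I ψ0⊆cl u
    ... | inj₁ (A , model) = step-run n C ψ0 ℓ A model I ψ0⊆cl bud

    step-run : ∀ n C ψ0 ℓ A → ⟦ query C ψ0 ℓ ⟧ A ≡ true → Invariant C → ψ0 ⊆ cl →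
               budget C ℓ < suc n → StepResult n C ψ0 ℓ A
    step-run n C ψ0 zero A model I ψ0⊆cl bud with solve (pand (xnfS (Xof (query C ψ0 zero) A)) Tail)
    ... | inj₁ (B , final) = true , C , refl , record
      { grows = ⊑-refl {C} ; invariant = I ; unchangedAbove = λ _ _ → refl
      ; outcome = step-sat ψ0 (pnot (XFrame (frameAt C zero))) A model
                    (λ _ → final-sat (Xof (query C ψ0 zero) A) B final) }
    ... | inj₂ u with getUC (Xof (query C ψ0 zero) A) Tail u
    ...   | (c , c⊆ψ' , c-unsat) =
      retry n C (addTo C 0 c) ψ0 zero A model I
        (inv-addTo C 0 c I (successor-inCl C ψ0 zero A I ψ0⊆cl ∘ c⊆ψ') (unsat-final c c-unsat))
        ψ0⊆cl (⊑-addTo C 0 c) (λ j lt → frameAt-addTo-other C c (<⇒≢ (<-trans (s≤s z≤n) lt)))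
        (c , ∈-addTo-same C 0 c , c⊆ψ') bud
    step-run n C ψ0 (suc ℓ) A model I ψ0⊆cl bud
      with trySatisfy n C (Xof (query C ψ0 (suc ℓ)) A) ℓ
         | trySatisfy-run n C (Xof (query C ψ0 (suc ℓ)) A) ℓ I
             (successor-inCl C ψ0 (suc ℓ) A I ψ0⊆cl) (budget-descend C C ℓ n bud)
    ... | .(just (true , C')) | (true , C' , refl , r) = true , C' , refl , record
      { grows = grows r ; invariant = invariant r
      ; unchangedAbove = λ j lt → unchangedAbove r j (≤-trans (n≤1+n _) lt)
      ; outcome = step-sat ψ0 (pnot (XFrame (frameAt C (suc ℓ)))) A model (λ _ → outcome r) }
    ... | .(just (false , C')) | (false , C' , refl , r) =
      retry n C C' ψ0 (suc ℓ) A model I (invariant r) ψ0⊆cl (grows r)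
        (λ j lt → unchangedAbove r j (≤-trans (n≤1+n _) lt)) (proj₂ (outcome r)) bud

    retry : ∀ n C C' ψ0 ℓ A → ⟦ query C ψ0 ℓ ⟧ A ≡ true → Invariant C → Invariant C' → ψ0 ⊆ cl →
            C ⊑ C' → (∀ j → suc ℓ < j → frameAt C' j ≡ frameAt C j) →
            (Σ State λ c → c ∈ frameAt C' ℓ × c ⊆ Xof (query C ψ0 ℓ) A) →
            budget C ℓ < suc n →
            Σ Bool λ b → Σ Frames λ C'' → trySatisfy n C' ψ0 ℓ ≡ just (b , C'') × Run C ψ0 ℓ b C''
    retry n C C' ψ0 ℓ A model I I' ψ0⊆cl C⊑C' same blocked bud
      with trySatisfy-run n C' ψ0 ℓ I' ψ0⊆cl
             (budget-retry C C' ℓ n (outside-decreases C C' ψ0 ℓ A I I' C⊑C' model blocked) bud)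
    ... | (b , C'' , e , r) = b , C'' , e , Run-after C⊑C' same r

  XUpTo-local : ∀ C i → Invariant C → Local (XUpTo C i)
  XUpTo-local C zero I = XFrame-local (frameAt C zero) (inCl I zero)
  XUpTo-local C (suc i) I A =
    cong₂ _∧_ (XUpTo-local C i I A) (XFrame-local (frameAt C (suc i)) (inCl I (suc i)) A)

  XUpTo-intro : ∀ C i A → (∀ m → m ≤ i → ⟦ XFrame (frameAt C m) ⟧ A ≡ true) → ⟦ XUpTo C i ⟧ A ≡ true
  XUpTo-intro C zero A h = h 0 z≤n
  XUpTo-intro C (suc i) A h = ∧-intro (XUpTo-intro C i A (λ m m≤i → h m (m≤n⇒m≤1+n m≤i))) (h (suc i) ≤-refl)

  Inductive : Frames → ℕ → Set
  Inductive C i = PUnsat (pand (XUpTo C i) (pnot (XFrame (frameAt C (suc i)))))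

  invAt-true : ∀ C i → invAt C i ≡ true → Inductive C i
  invAt-true C i with solve (pand (XUpTo C i) (pnot (XFrame (frameAt C (suc i)))))
  ... | inj₂ u = λ _ → u

  invAt-false : ∀ C i → invAt C i ≡ false → PSat (pand (XUpTo C i) (pnot (XFrame (frameAt C (suc i)))))
  invAt-false C i with solve (pand (XUpTo C i) (pnot (XFrame (frameAt C (suc i)))))
  ... | inj₁ s = λ _ → s

  invFound-true : ∀ C k → invFound C k ≡ true → Σ ℕ λ i → i ≤ k × Inductive C i
  invFound-true C zero e = 0 , z≤n , invAt-true C 0 e
  invFound-true C (suc k) e with ∨-split {invFound C k} e
  ... | inj₁ below with invFound-true C k below
  ...   | (i , i≤k , ind) = i , m≤n⇒m≤1+n i≤k , ind
  invFound-true C (suc k) e | inj₂ top = suc k , ≤-refl , invAt-true C (suc k) top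

  -- A failed inductiveness check at level i exhibits a pattern in
  -- C[0..i] but not in C[i+1], so C[0..i+1] has fewer patterns.
  models-shrink : ∀ C i → Invariant C → invAt C i ≡ false → models (XUpTo C (suc i)) < models (XUpTo C i)
  models-shrink C i I e with invAt-false C i e
  ... | (A , model) =
    fewer-models (XUpTo C i) (XUpTo C (suc i)) (XUpTo-local C i I) (XUpTo-local C (suc i) I)
      (λ S → proj₁ ∘ ∧-split) A (proj₁ (∧-split model))
      (cong₂ _∧_ (proj₁ (∧-split model)) (not-true (proj₂ (∧-split {⟦ XUpTo C i ⟧ A} model))))

  invFound-false : ∀ C k → Invariant C → invFound C k ≡ false →
                   suc k + models (XUpTo C (suc k)) ≤ models (XUpTo C 0)
  invFound-false C zero I e = models-shrink C 0 I e
  invFound-false C (suc k) I e = begin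
    suc (suc k) + models (XUpTo C (suc (suc k))) ≡⟨ sym (+-suc (suc k) _) ⟩
    suc k + suc (models (XUpTo C (suc (suc k)))) ≤⟨ +-monoʳ-≤ (suc k) (models-shrink C (suc k) I top) ⟩
    suc k + models (XUpTo C (suc k))              ≤⟨ invFound-false C k I below ⟩
    models (XUpTo C 0)                             ∎
    where
    open ≤-Reasoning
    below : invFound C k ≡ false
    below = ∨-conicalˡ (invFound C k) (invAt C (suc k)) e
    top : invAt C (suc k) ≡ false
    top = ∨-conicalʳ (invFound C k) (invAt C (suc k)) e

  invFound-bound : ∀ C k → Invariant C → invFound C k ≡ false → suc k ≤ N
  invFound-bound C k I e =
    ≤-trans (m≤m+n (suc k) _) (≤-trans (invFound-false C k I e) (models≤ (XUpTo C 0)))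

  NextInFrames : Frames → ℕ → Trace → ℕ → Set
  NextInFrames C i σ q = ∀ m → m ≤ i → ⟦ XFrame (frameAt C m) ⟧ (traceAsg σ q) ≡ true

  inFrames-extend : ∀ C i σ q → Inductive C i → NextInFrames C i σ q → NextInFrames C (suc i) σ q
  inFrames-extend C i σ q ind next m m≤si with m≤n⇒m<n∨m≡n m≤si
  ... | inj₁ m<si = next m (≤-pred m<si)
  ... | inj₂ refl = ∧-not-false (XUpTo-intro C i (traceAsg σ q) next) (ind (traceAsg σ q))

  -- If C[0..i] ⇒ C[i+1] holds, a next state in C[0..i] is followed by
  -- another one in C[0..i]: clauses of C[m+1] step into C[m].
  inFrames-step : ∀ C i σ q → Invariant C → Inductive C i → NextInFrames C i σ q →
                  suc q ≤ last σ → NextInFrames C i σ (suc q)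
  inFrames-step C i σ q I ind next sq≤l m m≤i
    with XFrame-true⁻ (frameAt C (suc m)) (traceAsg σ q) (inFrames-extend C i σ q ind next (suc m) (s≤s m≤i))
  ... | (c , mc , sets) = justified I (suc m) mc σ (suc q) sq≤l (traceAsg-step σ q c sets)

  -- A next state in C[0] is not final: clauses of C[0] are never final.
  inFrames-notLast : ∀ C i σ q → Invariant C → NextInFrames C i σ q → suc q ≢ last σ
  inFrames-notLast C i σ q I next eq with XFrame-true⁻ (frameAt C 0) _ (next 0 z≤n)
  ... | (c , mc , sets) = justified I 0 mc σ (subst (λ p → Holds σ p c) eq (traceAsg-step σ q c sets))

  inFrames-never : ∀ C i σ → Invariant C → Inductive C i → ∀ r q → suc q + r ≡ last σ →
                   NextInFrames C i σ q → ⊥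
  inFrames-never C i σ I ind zero q eq next =
    inFrames-notLast C i σ q I next (trans (sym (+-identityʳ (suc q))) eq)
  inFrames-never C i σ I ind (suc r) q eq next =
    inFrames-never C i σ I ind r (suc q) (trans (sym (+-suc (suc q) r)) eq)
      (inFrames-step C i σ q I ind next (subst (suc q ≤_) eq (m≤m+n (suc q) (suc r))))

  unsat-sound : ∀ C i φ → Invariant C → Inductive C i → PUnsat (pand (xnfS (φ ∷ [])) Tail) →
                (∀ m → m ≤ i → StepsInto (φ ∷ []) (frameAt C m)) → ¬ Satisfiable φ
  unsat-sound C i φ I ind notFinal steps (σ , h) with last σ in eq
  ... | zero = unsat-final (φ ∷ []) notFinal σ (subst (λ p → Holds σ p (φ ∷ [])) (sym eq) (h ∷ []))
  ... | suc r = inFrames-never C i σ I ind r 0 (sym eq) (λ m m≤i → steps m m≤i σ 0 z≤n (h ∷ []))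

  -- Fuel of the outer loop per remaining iteration, on top of the fuel
  -- needed by try_satisfy at any level k ≤ N.
  loopFuel : ℕ
  loopFuel = suc (N + N * K)

  budget-at : ∀ C k j n → k + j ≡ N → loopFuel + j < suc n → budget C k < n
  budget-at C k j n k+j fuel =
    ≤-trans (s≤s (+-mono-≤ (models≤ (pnot (XFrame (frameAt C k)))) (*-monoˡ-≤ K k≤N)))
            (≤-trans (m≤m+n loopFuel j) (≤-pred fuel))
    where
    k≤N : k ≤ N
    k≤N = subst (k ≤_) k+j (m≤m+n k j)

  module Loop (φ : Formula) (φ∈cl : φ ∈ cl) (notFinal : PUnsat (pand (xnfS (φ ∷ [])) Tail)) where

    φ⊆cl : (φ ∷ []) ⊆ cl
    φ⊆cl (here refl) = φ∈cl

    record Ready (C : Frames) (k : ℕ) : Set where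
      field
        invariant : Invariant C
        emptyAbove : ∀ j → k < j → frameAt C j ≡ []
        φ-steps : ∀ m → m < k → StepsInto (φ ∷ []) (frameAt C m)
    open Ready

    ready-init : Ready (((φ ∷ []) ∷ []) ∷ []) 0
    ready-init = record
      { invariant = record { inCl = λ { zero (here refl) (here refl) → φ∈cl }
                           ; justified = λ { zero (here refl) → unsat-final (φ ∷ []) notFinal } }
      ; emptyAbove = λ { (suc j) _ → refl }
      ; φ-steps = λ _ () }

    steps-after : ∀ {C k C'} → Ready C k → Run C (φ ∷ []) k false C' →
                  ∀ m → m ≤ k → StepsInto (φ ∷ []) (frameAt C' m)
    steps-after ready r m m≤k with m≤n⇒m<n∨m≡n m≤k
    ... | inj₁ m<k = StepsInto-mono (grows r m) (φ-steps ready m m<k)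
    ... | inj₂ refl = proj₁ (outcome r)

    ready-next : ∀ {C k C'} → Ready C k → Run C (φ ∷ []) k false C' → Ready (setEmpty C' (suc k)) (suc k)
    ready-next {C} {k} {C'} ready r = record
      { invariant = inv-setEmpty C' (suc k) (Run.invariant r)
                      (trans (unchangedAbove r _ ≤-refl) (emptyAbove ready _ (m≤n⇒m≤1+n (n<1+n k))))
      ; emptyAbove = λ j lt → trans (frameAt-setEmpty-other C' (<⇒≢ lt))
                                (trans (unchangedAbove r j lt) (emptyAbove ready j (<-trans (n<1+n k) lt)))
      ; φ-steps = λ m m<sk → subst (StepsInto (φ ∷ [])) (sym (frameAt-setEmpty-other C' (>⇒≢ m<sk)))
                                   (steps-after ready r m (≤-pred m<sk)) }

    -- The loop terminates with a correct answer; j bounds the remaining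
    -- iterations, since inv_found fails at most N times.
    loop-run : ∀ n C k j → k + j ≡ N → loopFuel + j < n → Ready C k →
               Σ Result λ r → loop n φ C k ≡ just r × Correct r φ
    loop-run (suc n) C k j k+j fuel ready
      with trySatisfy n C (φ ∷ []) k
         | trySatisfy-run n C (φ ∷ []) k (invariant ready) φ⊆cl (budget-at C k j n k+j fuel)
    ... | .(just (true , C')) | (true , C' , refl , r) = SAT , refl , satisfiable (outcome r)
    ... | .(just (false , C')) | (false , C' , refl , r) with invFound C' k in found
    ...   | true with invFound-true C' k found
    ...     | (i , i≤k , ind) = UNSAT , refl ,
              unsat-sound C' i φ (Run.invariant r) ind notFinal (λ m m≤i → steps-after ready r m (≤-trans m≤i i≤k))
    loop-run (suc n) C k j k+j fuel ready | _ | (false , C' , refl , r) | false with j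
    ... | zero = ⊥-elim (<-irrefl (trans (sym (+-identityʳ k)) k+j) (invFound-bound C' k (Run.invariant r) found))
    ... | suc j' = loop-run n (setEmpty C' (suc k)) (suc k) j' (trans (sym (+-suc k j')) k+j)
                     (≤-pred (subst (_< suc n) (+-suc loopFuel j') fuel)) (ready-next ready r)

  cdlsc-run : ∀ φ → φ ∈ cl → ∀ n → loopFuel + N < n → Σ Result λ r → CDLSC O n φ ≡ just r × Correct r φ
  cdlsc-run φ φ∈cl n fuel with solve (pand (xnfS (φ ∷ [])) Tail)
  ... | inj₁ (A , final) = SAT , refl , satisfiable (final-sat (φ ∷ []) A final)
  ... | inj₂ notFinal = Loop.loop-run φ φ∈cl notFinal n _ 0 N refl fuel (Loop.ready-init φ φ∈cl notFinal)

mainTheorem4 : (O : Oracle) (φ : Formula) →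
    Σ ℕ λ fuel → Σ Result λ r →
      (CDLSC O fuel φ ≡ just r)
      × (Satisfiable φ → r ≡ SAT)
      × (¬ Satisfiable φ → r ≡ UNSAT)
mainTheorem4 O φ with cdlsc-run φ (here refl) (suc (loopFuel + N)) ≤-refl
  where open Correctness O (sub φ) (sub-closed φ)
... | (r , run , correct) = _ , r , run , correct-answer r φ correct
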